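{- Let $\Gamma$ be a commutative weakly distance-regular digraph with $(1,2)\in\tilde\partial(\Gamma)$ and $\Gamma_{1,2}^2\subseteq\{\Gamma_{2,1},\Gamma_{2,2},\Gamma_{2,3},\Gamma_{2,4}\}$. Then: (i) if $\Gamma_{2,2}\in\Gamma_{1,2}^2$ and $(x,z)\in\Gamma_{2,2}$, then $P_{(1,2),(1,2)}(z,x)\subseteq P_{(2,2),(2,1)}(y,z)$ for all $y\in P_{(1,2),(1,2)}(x,z)$; (ii) if $\Gamma_{2,j}\in\Gamma_{1,2}^2$ and $(x',z')\in\Gamma_{2,j}$ with $j\in\{2,3\}$, then $P_{(1,2),(2,1)}(x',z')\subseteq P_{(2,2),(2,1)}(y',z')\cup P_{(2,3),(2,1)}(y',z')$ for all $y'\in P_{(1,2),(1,2)}(x',z')$.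
   Context: All digraphs are finite, simple, strongly connected and not undirected. $\partial(x,y)$ is the directed distance, $\tilde{\partial}(x,y)=(\partial(x,y),\partial(y,x))$, $\tilde{\partial}(\Gamma)$ the set of all such pairs. Weakly distance-regular: for all $\tilde h,\tilde i,\tilde j\in\tilde\partial(\Gamma)$ the number $p^{\tilde h}_{\tilde i,\tilde j}$ of $z$ with $\tilde\partial(x,z)=\tilde i$, $\tilde\partial(z,y)=\tilde j$ depends only on $\tilde h=\tilde\partial(x,y)$; commutative: $p^{\tilde h}_{\tilde i,\tilde j}=p^{\tilde h}_{\tilde j,\tilde i}$. $\Gamma_{\tilde i}=\{(x,y):\tilde\partial(x,y)=\tilde i\}$, $\Gamma_{a,b}=\Gamma_{(a,b)}$, $\Gamma_{\tilde i}(x)=\{y:\tilde\partial(x,y)=\tilde i\}$; $\Gamma_{1,2}^2=\{\Gamma_{\tilde h}:p^{\tilde h}_{(1,2),(1,2)}\neq0\}$. For $\tilde i,\tilde j\in\tilde\partial(\Gamma)$ and vertices $x,y$, $P_{\tilde i,\tilde j}(x,y)=\Gamma_{\tilde i}(x)\cap\Gamma_{\tilde j^*}(y)$, where $(a,b)^*=(b,a)$ (i.e. the set of $z$ with $\tilde\partial(x,z)=\tilde i$ and $\tilde\partial(z,y)=\tilde j$). -}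

module Defs where

open import Data.Nat using (ℕ; zero; suc; _<_)
open import Data.Nat.Properties using () renaming (_≟_ to _≟ℕ_)
open import Data.Bool using (Bool; true; false; _∧_; not)
open import Data.Fin using (Fin)
open import Data.Fin.Properties using () renaming (_≟_ to _≟F_)
open import Data.List using (List; length; filterᵇ; takeWhileᵇ; upTo; allFin)
open import Data.Bool.ListAction using (any)
open import Data.Product using (_×_; _,_; Σ; ∃)
open import Data.Product.Properties using (≡-dec)
open import Relation.Nullary using (¬_)
open import Relation.Nullary.Decidable using (⌊_⌋)
open import Relation.Binary.PropositionalEquality using (_≡_)

record Digraph : Set where
  field
    n        : ℕ
    adj      : Fin n → Fin n → Bool
    loopless : ∀ x → adj x x ≡ false

module _ (Γ : Digraph) where
  open Digraph Γ

  reach : ℕ → Fin n → Fin n → Bool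
  reach zero    x y = ⌊ x ≟F y ⌋
  reach (suc k) x y = any (λ z → adj x z ∧ reach k z y) (allFin n)

  StronglyConnected : Set
  StronglyConnected = ∀ x y → ∃ λ k → reach k x y ≡ true

  NotUndirected : Set
  NotUndirected = ∃ λ x → ∃ λ y → adj x y ≡ true × adj y x ≡ false

  -- directed distance ∂(x,y): least k < n with a walk of length k from x to y
  -- (always exists for strongly connected digraphs; a shortest walk has < n arcs)
  ∂ : Fin n → Fin n → ℕ
  ∂ x y = length (takeWhileᵇ (λ k → not (reach k x y)) (upTo n))

  ∂̃ : Fin n → Fin n → ℕ × ℕ
  ∂̃ x y = ∂ x y , ∂ y x

  In∂̃ : ℕ × ℕ → Set
  In∂̃ i = ∃ λ x → ∃ λ y → ∂̃ x y ≡ i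

  _≟²_ : (a b : ℕ × ℕ) → _
  _≟²_ = ≡-dec _≟ℕ_ _≟ℕ_

  p : ℕ × ℕ → ℕ × ℕ → Fin n → Fin n → ℕ
  p i j x y = length (filterᵇ (λ z → ⌊ ∂̃ x z ≟² i ⌋ ∧ ⌊ ∂̃ z y ≟² j ⌋) (allFin n))

  WeaklyDistanceRegular : Set
  WeaklyDistanceRegular =
    ∀ i j → In∂̃ i → In∂̃ j → ∀ x y x' y' → ∂̃ x y ≡ ∂̃ x' y' → p i j x y ≡ p i j x' y'

  Commutative : Set
  Commutative = ∀ i j → In∂̃ i → In∂̃ j → ∀ x y → p i j x y ≡ p j i x y

  P : ℕ × ℕ → ℕ × ℕ → Fin n → Fin n → Fin n → Set
  P i j x y z = ∂̃ x z ≡ i × ∂̃ z y ≡ j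

  -- Γ_h ∈ Γ_{1,2}^2 :  h ∈ ∂̃(Γ) and p^h_{(1,2),(1,2)} ≠ 0
  InSq12 : ℕ × ℕ → Set
  InSq12 h = ∃ λ x → ∃ λ y → ∂̃ x y ≡ h × ¬ (p (1 , 2) (1 , 2) x y ≡ 0)

{-# OPTIONS --safe #-}
module Submission where

-- Only one consequence of Γ²₁,₂ ⊆ {Γ₂,₁, Γ₂,₂, Γ₂,₃, Γ₂,₄} is needed: two consecutive
-- (1,2)-steps x → y → z always give ∂(x,z) = 2. This decides every distance in (i)
-- directly. In (ii) it gives ∂(y',w) = 2, while the triangle inequality along
-- w → x' → y' bounds ∂(w,y') by 3; the value 0 contradicts ∂(w,z') = 2 > ∂(y',z'),
-- and the value 1 would make x' → w → y' a pair of (1,2)-steps, forcing ∂(x',y') = 2.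

open import Defs
open import Data.Nat using (ℕ; zero; suc; _+_; _≤_; _<_; s≤s; z≤n; s<s⁻¹)
open import Data.Nat.Properties using (≤-trans; m≤m+n; m≤n+m; _<?_; ≮⇒≥; module ≤-Reasoning)
open import Data.Fin using (Fin)
open import Data.Bool using (Bool; true; false; not; T)
open import Data.Bool.Properties using (T-∧)
open import Data.List using (List; length; takeWhileᵇ; applyUpTo; allFin)
open import Data.List.Membership.Propositional using (_∈_; lose)
open import Data.List.Membership.Propositional.Properties using (∈-allFin; ∈-filter⁺)
open import Data.List.Relation.Unary.Any using (here; there; satisfied)
open import Data.List.Relation.Unary.Any.Properties using (any⁺; any⁻)
open import Data.Product using (_×_; _,_; proj₁; proj₂; swap)
open import Data.Sum as Sum using (_⊎_; inj₁; inj₂)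
open import Function using (_∘_; Equivalence)
open import Relation.Nullary using (¬_; yes; no; contradiction)
open import Relation.Nullary.Decidable using (toWitness; fromWitness)
open import Relation.Binary.PropositionalEquality using (_≡_; _≢_; refl; sym; trans; cong; cong₂; subst)

module _ {A : Set} (q : A → Bool) where

  length-takeWhileᵇ-applyUpTo : ∀ (f : ℕ → A) n →
    length (takeWhileᵇ (not ∘ q) (applyUpTo f n)) ≤ n
  length-takeWhileᵇ-applyUpTo f zero = z≤n
  length-takeWhileᵇ-applyUpTo f (suc n) with q (f 0)
  ... | false = s≤s (length-takeWhileᵇ-applyUpTo (f ∘ suc) n)
  ... | true  = z≤n

  takeWhileᵇ-applyUpTo-before : ∀ (f : ℕ → A) n m →
    m < length (takeWhileᵇ (not ∘ q) (applyUpTo f n)) → ¬ T (q (f m))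
  takeWhileᵇ-applyUpTo-before f (suc n) m m< with q (f 0) in eq
  takeWhileᵇ-applyUpTo-before f (suc n) zero    _         | false =
    subst T eq
  takeWhileᵇ-applyUpTo-before f (suc n) (suc m) (s≤s m<) | false =
    takeWhileᵇ-applyUpTo-before (f ∘ suc) n m m<

  takeWhileᵇ-applyUpTo-stop : ∀ (f : ℕ → A) n →
    let ℓ = length (takeWhileᵇ (not ∘ q) (applyUpTo f n)) in ℓ < n → T (q (f ℓ))
  takeWhileᵇ-applyUpTo-stop f (suc n) ℓ< with q (f 0) in eq
  ... | false = takeWhileᵇ-applyUpTo-stop (f ∘ suc) n (s<s⁻¹ ℓ<)
  ... | true  = subst T (sym eq) _

module _ (Γ : Digraph) where
  open Digraph Γ using (n)

  ∂≤n : ∀ x y → ∂ Γ x y ≤ n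
  ∂≤n x y = length-takeWhileᵇ-applyUpTo (λ k → reach Γ k x y) (λ k → k) n

  reach-∂ : ∀ x y → ∂ Γ x y < n → T (reach Γ (∂ Γ x y) x y)
  reach-∂ x y = takeWhileᵇ-applyUpTo-stop (λ k → reach Γ k x y) (λ k → k) n

  ∂-minimal : ∀ {k x y} → T (reach Γ k x y) → ∂ Γ x y ≤ k
  ∂-minimal {k} {x} {y} walk = ≮⇒≥ λ k<∂ →
    takeWhileᵇ-applyUpTo-before (λ m → reach Γ m x y) (λ k → k) n k k<∂ walk

  reach-+ : ∀ a {b x y z} → T (reach Γ a x y) → T (reach Γ b y z) → T (reach Γ (a + b) x z)
  reach-+ zero    x≡y   walk with refl ← toWitness x≡y = walk
  reach-+ (suc a) walk₁ walk₂
    with u , arc∧walk ← satisfied (any⁻ _ (allFin n) walk₁)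
    with arc , walk₁′ ← Equivalence.to T-∧ arc∧walk =
    any⁺ _ (lose (∈-allFin u) (Equivalence.from T-∧ (arc , reach-+ a walk₁′ walk₂)))

  -- ∂ is capped at n, so the inequality is trivial once either summand reaches the cap.
  ∂-triangle : ∀ x y z → ∂ Γ x z ≤ ∂ Γ x y + ∂ Γ y z
  ∂-triangle x y z with ∂ Γ x y <? n | ∂ Γ y z <? n
  ... | yes ∂xy<n | yes ∂yz<n = ∂-minimal (reach-+ (∂ Γ x y) (reach-∂ x y ∂xy<n) (reach-∂ y z ∂yz<n))
  ... | no ∂xy≮n  | _         = ≤-trans (∂≤n x z) (≤-trans (≮⇒≥ ∂xy≮n) (m≤m+n _ _))
  ... | yes _     | no ∂yz≮n  = ≤-trans (∂≤n x z) (≤-trans (≮⇒≥ ∂yz≮n) (m≤n+m _ _))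

  P⇒p≢0 : ∀ {i j x y z} → P Γ i j x y z → p Γ i j x y ≢ 0
  P⇒p≢0 {i} {j} {x} {y} {z} (xz≡i , zy≡j) = nonempty (∈-filter⁺ _ (∈-allFin z)
    (Equivalence.from T-∧ (fromWitness {a? = _≟²_ Γ (∂̃ Γ x z) i} xz≡i ,
                           fromWitness {a? = _≟²_ Γ (∂̃ Γ z y) j} zy≡j)))
    where nonempty : ∀ {xs : List (Fin n)} → z ∈ xs → length xs ≢ 0
          nonempty (here _)  ()
          nonempty (there _) ()

  open ≤-Reasoning

  module _ (Γ²₁₂-row2 : ∀ h → InSq12 Γ h → proj₁ h ≡ 2) where

    P₁₂₁₂⇒∂≡2 : ∀ {x y z} → P Γ (1 , 2) (1 , 2) x y z → ∂ Γ x y ≡ 2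
    P₁₂₁₂⇒∂≡2 {x} {y} xzy = Γ²₁₂-row2 (∂̃ Γ x y) (x , y , refl , P⇒p≢0 xzy)

    P₁₂₁₂⊆P₂₂₂₁ : ∀ {x y z w} → P Γ (1 , 2) (1 , 2) x z y → P Γ (1 , 2) (1 , 2) z x w →
                  P Γ (2 , 2) (2 , 1) y z w
    P₁₂₁₂⊆P₂₂₂₁ (xy , yz) (zw , wx) = cong₂ _,_ (P₁₂₁₂⇒∂≡2 (yz , zw)) (P₁₂₁₂⇒∂≡2 (wx , xy)) , cong swap zw

    P₁₂₂₁⊆P₂₂₂₁∪P₂₃₂₁ : ∀ {x y z w} → P Γ (1 , 2) (1 , 2) x z y → P Γ (1 , 2) (2 , 1) x z w →
                        P Γ (2 , 2) (2 , 1) y z w ⊎ P Γ (2 , 3) (2 , 1) y z w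
    P₁₂₂₁⊆P₂₂₂₁∪P₂₃₂₁ {x} {y} {z} {w} (xy , yz) (xw , wz) =
      Sum.map (λ ∂wy≡2 → cong₂ _,_ ∂yw≡2 ∂wy≡2 , wz) (λ ∂wy≡3 → cong₂ _,_ ∂yw≡2 ∂wy≡3 , wz)
              (two-or-three ∂wy≤3 ∂wy≢0 ∂wy≢1)
      where
      ∂yw≡2 : ∂ Γ y w ≡ 2
      ∂yw≡2 = P₁₂₁₂⇒∂≡2 (yz , cong swap wz)

      ∂wy≤3 : ∂ Γ w y ≤ 3
      ∂wy≤3 = begin
        ∂ Γ w y             ≤⟨ ∂-triangle w x y ⟩
        ∂ Γ w x + ∂ Γ x y   ≡⟨ cong₂ _+_ (cong proj₂ xw) (cong proj₁ xy) ⟩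
        3                   ∎

      ∂wy≢0 : ∂ Γ w y ≢ 0
      ∂wy≢0 ∂wy≡0 = contradiction 2≤1 λ where (s≤s ())
        where
        2≤1 : 2 ≤ 1
        2≤1 = begin
          2                   ≡⟨ cong proj₁ wz ⟨
          ∂ Γ w z             ≤⟨ ∂-triangle w y z ⟩
          ∂ Γ w y + ∂ Γ y z   ≡⟨ cong₂ _+_ ∂wy≡0 (cong proj₁ yz) ⟩
          1                   ∎

      ∂wy≢1 : ∂ Γ w y ≢ 1
      ∂wy≢1 ∂wy≡1 = contradiction (trans (sym (cong proj₁ xy)) ∂xy≡2) λ ()
        where
        ∂xy≡2 : ∂ Γ x y ≡ 2
        ∂xy≡2 = P₁₂₁₂⇒∂≡2 (xw , cong₂ _,_ ∂wy≡1 ∂yw≡2)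

      two-or-three : ∀ {d} → d ≤ 3 → d ≢ 0 → d ≢ 1 → d ≡ 2 ⊎ d ≡ 3
      two-or-three {0} _ d≢0 _ = contradiction refl d≢0
      two-or-three {1} _ _ d≢1 = contradiction refl d≢1
      two-or-three {2} _ _ _   = inj₁ refl
      two-or-three {3} _ _ _   = inj₂ refl
      two-or-three {suc (suc (suc (suc _)))} (s≤s (s≤s (s≤s ()))) _ _

lemma2p6 : (Γ : Digraph) → StronglyConnected Γ → NotUndirected Γ →
    WeaklyDistanceRegular Γ → Commutative Γ → In∂̃ Γ (1 , 2) →
    (∀ h → InSq12 Γ h → (h ≡ (2 , 1)) ⊎ (h ≡ (2 , 2)) ⊎ (h ≡ (2 , 3)) ⊎ (h ≡ (2 , 4))) →
    (InSq12 Γ (2 , 2) →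
      ∀ (x z : Fin (Digraph.n Γ)) → ∂̃ Γ x z ≡ (2 , 2) →
      ∀ y → P Γ (1 , 2) (1 , 2) x z y →
      ∀ w → P Γ (1 , 2) (1 , 2) z x w → P Γ (2 , 2) (2 , 1) y z w)
    ×
    (∀ (j : ℕ) → (j ≡ 2) ⊎ (j ≡ 3) → InSq12 Γ (2 , j) →
      ∀ (x' z' : Fin (Digraph.n Γ)) → ∂̃ Γ x' z' ≡ (2 , j) →
      ∀ y' → P Γ (1 , 2) (1 , 2) x' z' y' →
      ∀ w → P Γ (1 , 2) (2 , 1) x' z' w →
      P Γ (2 , 2) (2 , 1) y' z' w ⊎ P Γ (2 , 3) (2 , 1) y' z' w)
lemma2p6 Γ _ _ _ _ _ Γ²₁₂⊆ =
    (λ _ _ _ _ _ y∈P _ w∈P → P₁₂₁₂⊆P₂₂₂₁ Γ Γ²₁₂-row2 y∈P w∈P)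
  , (λ _ _ _ _ _ _ _ y'∈P _ w∈P → P₁₂₂₁⊆P₂₂₂₁∪P₂₃₂₁ Γ Γ²₁₂-row2 y'∈P w∈P)
  where
  Γ²₁₂-row2 : ∀ h → InSq12 Γ h → proj₁ h ≡ 2
  Γ²₁₂-row2 h h∈Γ²₁₂ with Γ²₁₂⊆ h h∈Γ²₁₂
  ... | inj₁ refl                 = refl
  ... | inj₂ (inj₁ refl)          = refl
  ... | inj₂ (inj₂ (inj₁ refl))   = refl
  ... | inj₂ (inj₂ (inj₂ refl))   = refl
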